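{- Let $(G,\sigma)$ be a finite simple graph with a linear vertex ordering, and consider $(G\Box G,\mathrm{lex})$. Let $\mathcal{C}$ be any proper vertex coloring of $G\Box G$ using $\chi(G\Box G)$ colors. If $\mathcal{C}$ is descent-free (with respect to $\mathrm{lex}$), then $\chi(G)=FF(G\Box G,\mathrm{lex})=2^k$ for some integer $k\ge 0$.
   Context: $G\Box G$ is the Cartesian product: vertex set $V(G)\times V(G)$, with $(u,v)\sim(u',v')$ iff either $u=u'$ and $vv'\in E(G)$, or $uu'\in E(G)$ and $v=v'$. $\mathrm{lex}$: $(u,v)$ precedes $(u',v')$ iff $\sigma(u)<\sigma(u')$, or $u=u'$ and $\sigma(v)<\sigma(v')$. First-Fit coloring: scan vertices in order, give each the smallest positive integer not used on previously colored neighbors; $FF$ is the number of colors used. Descent: for a proper coloring $\mathcal{C}$ with colors $1,\ldots,k$, colors $x<y$ and a vertex $v$ of color $y$, with $N$ the set of neighbors of $v$ of color $x$, $\{v\}\cup N$ is a descent if every $u\in N$ comes after $v$ in the ordering (if $N=\emptyset$, $\{v\}$ is a descent); $\mathcal{C}$ is descent-free if no descent exists. -}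

module Defs where

open import Level using (0ℓ)
open import Data.Nat using (ℕ; _≤_; _<_)
open import Data.Fin using (Fin; toℕ)
open import Data.Product using (Σ; ∃; _×_; _,_)
open import Relation.Binary.PropositionalEquality using (_≡_; _≢_)
open import Relation.Nullary using (¬_; Dec)
open import Function.Definitions using (Injective)

record SimpleGraph (n : ℕ) : Set₁ where
  field
    Adj    : Fin n → Fin n → Set
    dec    : ∀ u v → Dec (Adj u v)
    sym    : ∀ {u v} → Adj u v → Adj v u
    irrefl : ∀ {u} → ¬ Adj u u
open SimpleGraph public

-- A linear ordering σ of V(G): an injective (hence bijective) labelling Fin n → Fin n;
-- u precedes v iff σ u < σ v.
LinearOrdering : ℕ → Set
LinearOrdering n = Σ (Fin n → Fin n) (λ σ → Injective _≡_ _≡_ σ)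

BoxAdj : ∀ {n} → SimpleGraph n → Fin n × Fin n → Fin n × Fin n → Set
BoxAdj G (u , v) (u' , v') = (u ≡ u' × Adj G v v') ⊎' (Adj G u u' × v ≡ v')
  where
  open import Data.Sum renaming (_⊎_ to _⊎'_)

Lex : ∀ {n} → LinearOrdering n → Fin n × Fin n → Fin n × Fin n → Set
Lex (σ , _) (u , v) (u' , v') =
  (toℕ (σ u) < toℕ (σ u')) ⊎' (u ≡ u' × toℕ (σ v) < toℕ (σ v'))
  where
  open import Data.Sum renaming (_⊎_ to _⊎'_)

module _ {V : Set} (A : V → V → Set) where

  ProperColoring : ℕ → (V → ℕ) → Set
  ProperColoring k c =
    (∀ v → 1 ≤ c v × c v ≤ k) × (∀ u v → A u v → c u ≢ c v)

  IsChromaticNumber : ℕ → Set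
  IsChromaticNumber k =
    (∃ λ c → ProperColoring k c) × (∀ m c → ProperColoring m c → k ≤ m)

  UsesExactly : (V → ℕ) → ℕ → Set
  UsesExactly c k =
    Σ (Fin k → ℕ) λ f → Injective _≡_ _≡_ f
      × (∀ i → ∃ λ v → c v ≡ f i) × (∀ v → ∃ λ i → f i ≡ c v)

  module _ (before : V → V → Set) where

    IsFirstFit : (V → ℕ) → Set
    IsFirstFit c = ∀ v →
        1 ≤ c v
      × (∀ u → A u v → before u v → c u ≢ c v)
      × (∀ m → 1 ≤ m → m < c v → ∃ λ u → A u v × before u v × c u ≡ m)

    FFNumber : ℕ → Set
    FFNumber k = ∃ λ c → IsFirstFit c × UsesExactly c k

    -- a descent {v} ∪ N for colors x < y (colors of a coloring with colors 1..k)
    IsDescent : (V → ℕ) → ℕ → ℕ → V → Set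
    IsDescent c x y v =
      1 ≤ x × x < y × c v ≡ y × (∀ u → A v u → c u ≡ x → before v u)

    DescentFree : (V → ℕ) → Set
    DescentFree c = ∀ x y v → ¬ IsDescent c x y v

-- A descent-free proper colouring is the First-Fit colouring for lex.  By induction along lex,
-- the First-Fit colouring of G □ G is (u , v) ↦ 1 + (a u ⊕ a v), where 1 + a is the First-Fit
-- colouring of G (read off the row of the σ-least vertex) and ⊕ is nim addition: every smaller
-- value is the nim sum of an option, which First-Fit on G realises on an earlier neighbour, and a
-- larger value would need an earlier neighbour with the same nim sum, excluded by cancellation.
-- As χ(G □ G) = χ(G), that row uses every colour 1, …, k.  If 2 ^ t < k < 2 ^ (t + 1), the
-- colours 2 ^ t + 1 and 2 ^ t in it give the colour 1 + (2 ^ t ⊕ (2 ^ t - 1)) = 2 ^ (t + 1) > k.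
module Submission where

open import Defs hiding (sym; irrefl; dec)
open import Data.Nat
open import Data.Nat.Properties
open import Data.Nat.DivMod
open import Data.Nat.Solver using (module +-*-Solver)
open import Data.Fin using (Fin; zero; toℕ; fromℕ<)
open import Data.Fin.Properties using (any?; toℕ-injective; toℕ<n; toℕ-fromℕ<)
  renaming (_≟_ to _≟ᶠ_)
open import Data.Product using (Σ; ∃; _×_; _,_; proj₁; proj₂)
open import Data.Sum as Sum using (_⊎_; inj₁; inj₂)
open import Relation.Binary.PropositionalEquality
open import Relation.Nullary using (¬_; Dec; yes; no; contradiction)
open import Relation.Nullary.Decidable using (map′; _×-dec_; _⊎-dec_)
open import Relation.Binary using (Decidable; Symmetric; tri<; tri≈; tri>)
open import Relation.Binary.Construct.On as On using ()
open import Induction.WellFounded using (WellFounded; WfRec; module All)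
open import Data.Nat.Induction using (<-wellFounded)
open import Data.Product.Relation.Binary.Lex.Strict using (×-wellFounded)
open import Data.Empty using (⊥; ⊥-elim)
open import Function using (id; _∘_)
open ≡-Reasoning

-- Nim addition

-- For a, b < 2 ^ t this is the bitwise exclusive or of a and b, computed from the top bit
-- down; outside that range the value is junk.
nim : ℕ → ℕ → ℕ → ℕ
nim zero    a b = 0
nim (suc t) a b with a <? 2 ^ t | b <? 2 ^ t
... | yes _ | yes _ = nim t a b
... | no _  | yes _ = 2 ^ t + nim t (a ∸ 2 ^ t) b
... | yes _ | no _  = 2 ^ t + nim t a (b ∸ 2 ^ t)
... | no _  | no _  = nim t (a ∸ 2 ^ t) (b ∸ 2 ^ t)

2^suc≡2^+2^ : ∀ t → 2 ^ suc t ≡ 2 ^ t + 2 ^ t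
2^suc≡2^+2^ t = cong (2 ^ t +_) (+-identityʳ (2 ^ t))

<2^⇒<2^suc : ∀ t {x} → x < 2 ^ t → x < 2 ^ suc t
<2^⇒<2^suc t x< = <-≤-trans x< (^-monoʳ-≤ 2 (n≤1+n t))

<2^⇒2^+<2^suc : ∀ t {x} → x < 2 ^ t → 2 ^ t + x < 2 ^ suc t
<2^⇒2^+<2^suc t x< = <-≤-trans (+-monoʳ-< (2 ^ t) x<) (≤-reflexive (sym (2^suc≡2^+2^ t)))

data TopBit (h : ℕ) : ℕ → Set where
  low  : ∀ {x} → x < h → TopBit h x
  high : ∀ {x} → x < h → TopBit h (h + x)

topBit : ∀ t {x} → x < 2 ^ suc t → TopBit (2 ^ t) x
topBit t {x} x< with x <? 2 ^ t
... | yes x<h = low x<h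
... | no  x≮h = subst (TopBit (2 ^ t)) (m+[n∸m]≡n (≮⇒≥ x≮h))
  (high (m<n+o⇒m∸n<o x (2 ^ t) {{m^n≢0 2 t}} (<-≤-trans x< (≤-reflexive (2^suc≡2^+2^ t)))))

nim-low-low : ∀ t {a b} → a < 2 ^ t → b < 2 ^ t → nim (suc t) a b ≡ nim t a b
nim-low-low t {a} {b} a<h b<h with a <? 2 ^ t | b <? 2 ^ t
... | yes _   | yes _   = refl
... | no  a≮h | _       = contradiction a<h a≮h
... | yes _   | no  b≮h = contradiction b<h b≮h

nim-high-low : ∀ t {a b} → b < 2 ^ t → nim (suc t) (2 ^ t + a) b ≡ 2 ^ t + nim t a b
nim-high-low t {a} {b} b<h with 2 ^ t + a <? 2 ^ t | b <? 2 ^ t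
... | yes h+a<h | _       = contradiction h+a<h (m+n≮m (2 ^ t) a)
... | no _      | yes _   = cong (λ x → 2 ^ t + nim t x b) (m+n∸m≡n (2 ^ t) a)
... | no _      | no  b≮h = contradiction b<h b≮h

nim-low-high : ∀ t {a b} → a < 2 ^ t → nim (suc t) a (2 ^ t + b) ≡ 2 ^ t + nim t a b
nim-low-high t {a} {b} a<h with a <? 2 ^ t | 2 ^ t + b <? 2 ^ t
... | _       | yes h+b<h = contradiction h+b<h (m+n≮m (2 ^ t) b)
... | yes _   | no _      = cong (λ x → 2 ^ t + nim t a x) (m+n∸m≡n (2 ^ t) b)
... | no  a≮h | no _      = contradiction a<h a≮h

nim-high-high : ∀ t a b → nim (suc t) (2 ^ t + a) (2 ^ t + b) ≡ nim t a b
nim-high-high t a b with 2 ^ t + a <? 2 ^ t | 2 ^ t + b <? 2 ^ t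
... | yes h+a<h | _         = contradiction h+a<h (m+n≮m (2 ^ t) a)
... | no _      | yes h+b<h = contradiction h+b<h (m+n≮m (2 ^ t) b)
... | no _      | no _      = cong₂ (nim t) (m+n∸m≡n (2 ^ t) a) (m+n∸m≡n (2 ^ t) b)

nim-< : ∀ t {a b} → a < 2 ^ t → b < 2 ^ t → nim t a b < 2 ^ t
nim-< zero    _  _  = z<s
nim-< (suc t) a< b< with topBit t a< | topBit t b<
... | low p  | low q  = ≤-<-trans (≤-reflexive (nim-low-low t p q)) (<2^⇒<2^suc t (nim-< t p q))
... | high p | low q  = ≤-<-trans (≤-reflexive (nim-high-low t q)) (<2^⇒2^+<2^suc t (nim-< t p q))
... | low p  | high q = ≤-<-trans (≤-reflexive (nim-low-high t p)) (<2^⇒2^+<2^suc t (nim-< t p q))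
... | high p | high q = ≤-<-trans (≤-reflexive (nim-high-high t _ _)) (<2^⇒<2^suc t (nim-< t p q))

nim-comm : ∀ t {a b} → a < 2 ^ t → b < 2 ^ t → nim t a b ≡ nim t b a
nim-comm zero    _  _  = refl
nim-comm (suc t) a< b< with topBit t a< | topBit t b<
... | low p  | low q  = trans (nim-low-low t p q) (trans (nim-comm t p q) (sym (nim-low-low t q p)))
... | high p | low q  =
  trans (nim-high-low t q) (trans (cong (2 ^ t +_) (nim-comm t p q)) (sym (nim-low-high t q)))
... | low p  | high q =
  trans (nim-low-high t p) (trans (cong (2 ^ t +_) (nim-comm t p q)) (sym (nim-high-low t p)))
... | high p | high q = trans (nim-high-high t _ _) (trans (nim-comm t p q) (sym (nim-high-high t _ _)))

nim-identityˡ : ∀ t {b} → b < 2 ^ t → nim t 0 b ≡ b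
nim-identityˡ zero    {zero}  _         = refl
nim-identityˡ zero    {suc _} (s<s ())
nim-identityˡ (suc t) b< with topBit t b<
... | low q  = trans (nim-low-low t (m^n>0 2 t) q) (nim-identityˡ t q)
... | high q = trans (nim-low-high t (m^n>0 2 t)) (cong (2 ^ t +_) (nim-identityˡ t q))

nim-selfInverseʳ : ∀ t {a b} → a < 2 ^ t → b < 2 ^ t → nim t (nim t a b) b ≡ a
nim-selfInverseʳ zero    {zero}  _         _ = refl
nim-selfInverseʳ zero    {suc _} (s<s ()) _
nim-selfInverseʳ (suc t) {a} {b} a< b< with topBit t a< | topBit t b<
... | low p  | low q  = begin
  nim (suc t) (nim (suc t) a b) b ≡⟨ cong (λ x → nim (suc t) x b) (nim-low-low t p q) ⟩
  nim (suc t) (nim t a b) b       ≡⟨ nim-low-low t (nim-< t p q) q ⟩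
  nim t (nim t a b) b             ≡⟨ nim-selfInverseʳ t p q ⟩
  a                               ∎
... | high {x} p | low q  = begin
  nim (suc t) (nim (suc t) (2 ^ t + x) b) b ≡⟨ cong (λ y → nim (suc t) y b) (nim-high-low t q) ⟩
  nim (suc t) (2 ^ t + nim t x b) b         ≡⟨ nim-high-low t q ⟩
  2 ^ t + nim t (nim t x b) b               ≡⟨ cong (2 ^ t +_) (nim-selfInverseʳ t p q) ⟩
  2 ^ t + x                                 ∎
... | low p  | high {y} q = begin
  nim (suc t) (nim (suc t) a (2 ^ t + y)) (2 ^ t + y)
    ≡⟨ cong (λ z → nim (suc t) z (2 ^ t + y)) (nim-low-high t p) ⟩
  nim (suc t) (2 ^ t + nim t a y) (2 ^ t + y)
    ≡⟨ nim-high-high t _ _ ⟩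
  nim t (nim t a y) y
    ≡⟨ nim-selfInverseʳ t p q ⟩
  a ∎
... | high {x} p | high {y} q = begin
  nim (suc t) (nim (suc t) (2 ^ t + x) (2 ^ t + y)) (2 ^ t + y)
    ≡⟨ cong (λ z → nim (suc t) z (2 ^ t + y)) (nim-high-high t x y) ⟩
  nim (suc t) (nim t x y) (2 ^ t + y)
    ≡⟨ nim-low-high t (nim-< t p q) ⟩
  2 ^ t + nim t (nim t x y) y
    ≡⟨ cong (2 ^ t +_) (nim-selfInverseʳ t p q) ⟩
  2 ^ t + x ∎

nim-cancelʳ-≡ : ∀ t {a a' b} → a < 2 ^ t → a' < 2 ^ t → b < 2 ^ t
  → nim t a b ≡ nim t a' b → a ≡ a'
nim-cancelʳ-≡ t {a} {a'} {b} a< a'< b< eq = begin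
  a                    ≡⟨ nim-selfInverseʳ t a< b< ⟨
  nim t (nim t a b) b  ≡⟨ cong (λ x → nim t x b) eq ⟩
  nim t (nim t a' b) b ≡⟨ nim-selfInverseʳ t a'< b< ⟩
  a'                   ∎

nim-cancelˡ-≡ : ∀ t {a b b'} → a < 2 ^ t → b < 2 ^ t → b' < 2 ^ t
  → nim t a b ≡ nim t a b' → b ≡ b'
nim-cancelˡ-≡ t a< b< b'< eq =
  nim-cancelʳ-≡ t b< b'< a< (trans (nim-comm t b< a<) (trans eq (nim-comm t a< b'<)))

OptionValue : ℕ → ℕ → ℕ → ℕ → Set
OptionValue t a b w = (∃ λ a' → a' < a × nim t a' b ≡ w) ⊎ (∃ λ b' → b' < b × nim t a b' ≡ w)

optionValue-swap : ∀ t {a b w} → a < 2 ^ t → b < 2 ^ t → OptionValue t b a w → OptionValue t a b w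
optionValue-swap t a< b< (inj₁ (b' , b'<b , e)) =
  inj₂ (b' , b'<b , trans (nim-comm t a< (<-trans b'<b b<)) e)
optionValue-swap t a< b< (inj₂ (a' , a'<a , e)) =
  inj₁ (a' , a'<a , trans (nim-comm t (<-trans a'<a a<) b<) e)

module NimMexStep (t : ℕ)
  (nim-mex : ∀ {a b w} → a < 2 ^ t → b < 2 ^ t → w < nim t a b → OptionValue t a b w) where

  mex-low-low : ∀ {a b w} → a < 2 ^ t → b < 2 ^ t → w < nim (suc t) a b
              → OptionValue (suc t) a b w
  mex-low-low a< b< w< =
    Sum.map (λ (a' , a'<a , e) → a' , a'<a , trans (nim-low-low t (<-trans a'<a a<) b<) e)
            (λ (b' , b'<b , e) → b' , b'<b , trans (nim-low-low t a< (<-trans b'<b b<)) e)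
            (nim-mex a< b< (<-≤-trans w< (≤-reflexive (nim-low-low t a< b<))))

  mex-high-low : ∀ {x b w} → x < 2 ^ t → b < 2 ^ t → w < nim (suc t) (2 ^ t + x) b
               → OptionValue (suc t) (2 ^ t + x) b w
  mex-high-low {x} {b} x< b< w<
    with topBit t (<-trans w< (nim-< (suc t) (<2^⇒2^+<2^suc t x<) (<2^⇒<2^suc t b<)))
  ... | low {w} w<h =
    inj₁ (nim t w b , <-≤-trans (nim-< t w<h b<) (m≤m+n (2 ^ t) x) ,
          trans (nim-low-low t (nim-< t w<h b<) b<) (nim-selfInverseʳ t w<h b<))
  ... | high {y} _ =
    Sum.map (λ (a' , a'<x , e) → 2 ^ t + a' , +-monoʳ-< (2 ^ t) a'<x ,
                                  trans (nim-high-low t b<) (cong (2 ^ t +_) e))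
            (λ (b' , b'<b , e) → b' , b'<b , trans (nim-high-low t (<-trans b'<b b<)) (cong (2 ^ t +_) e))
            (nim-mex x< b< (+-cancelˡ-< (2 ^ t) y _ (<-≤-trans w< (≤-reflexive (nim-high-low t b<)))))

  mex-high-high : ∀ {x y w} → x < 2 ^ t → y < 2 ^ t → w < nim (suc t) (2 ^ t + x) (2 ^ t + y)
                → OptionValue (suc t) (2 ^ t + x) (2 ^ t + y) w
  mex-high-high {x} {y} x< y< w< =
    Sum.map (λ (a' , a'<x , e) → 2 ^ t + a' , +-monoʳ-< (2 ^ t) a'<x , trans (nim-high-high t a' y) e)
            (λ (b' , b'<y , e) → 2 ^ t + b' , +-monoʳ-< (2 ^ t) b'<y , trans (nim-high-high t x b') e)
            (nim-mex x< y< (<-≤-trans w< (≤-reflexive (nim-high-high t x y))))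

  mex-suc : ∀ {a b w} → a < 2 ^ suc t → b < 2 ^ suc t → w < nim (suc t) a b
          → OptionValue (suc t) a b w
  mex-suc a< b< w< with topBit t a< | topBit t b<
  ... | low p  | low q  = mex-low-low p q w<
  ... | high p | low q  = mex-high-low p q w<
  ... | low p  | high q = optionValue-swap (suc t) a< b<
                            (mex-high-low q p (<-≤-trans w< (≤-reflexive (nim-comm (suc t) a< b<))))
  ... | high p | high q = mex-high-high p q w<

-- Every value below nim t a b is an option value: this is the half of "nim t a b is the
-- minimal excludant of the option values" that First-Fit needs.
nim-mex : ∀ t {a b w} → a < 2 ^ t → b < 2 ^ t → w < nim t a b → OptionValue t a b w
nim-mex zero    _ _ ()
nim-mex (suc t) = NimMexStep.mex-suc t (nim-mex t)

nim-2^t-pred : ∀ t → suc (nim (suc t) (2 ^ t) (pred (2 ^ t))) ≡ 2 ^ suc t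
nim-2^t-pred t = begin
  suc (nim (suc t) (2 ^ t) (pred (2 ^ t)))
    ≡⟨ cong (λ a → suc (nim (suc t) a (pred (2 ^ t)))) (+-identityʳ (2 ^ t)) ⟨
  suc (nim (suc t) (2 ^ t + 0) (pred (2 ^ t)))
    ≡⟨ cong suc (nim-high-low t pred<) ⟩
  suc (2 ^ t + nim t 0 (pred (2 ^ t)))
    ≡⟨ cong (λ x → suc (2 ^ t + x)) (nim-identityˡ t pred<) ⟩
  suc (2 ^ t + pred (2 ^ t))
    ≡⟨ +-suc (2 ^ t) _ ⟨
  2 ^ t + suc (pred (2 ^ t))
    ≡⟨ cong (2 ^ t +_) suc-pred-2^t ⟩
  2 ^ t + 2 ^ t
    ≡⟨ 2^suc≡2^+2^ t ⟨
  2 ^ suc t ∎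
  where
  suc-pred-2^t : suc (pred (2 ^ t)) ≡ 2 ^ t
  suc-pred-2^t = suc-pred (2 ^ t) {{m^n≢0 2 t}}
  pred< : pred (2 ^ t) < 2 ^ t
  pred< = ≤-reflexive suc-pred-2^t

n<2^n : ∀ n → n < 2 ^ n
n<2^n zero    = z<s
n<2^n (suc n) = ≤-<-trans (≤-reflexive (+-comm 1 n))
  (<-≤-trans (+-mono-<-≤ (n<2^n n) (m^n>0 2 n)) (≤-reflexive (sym (2^suc≡2^+2^ n))))

powerOfTwo⊎between : ∀ k → 1 ≤ k
  → (∃ λ e → k ≡ 2 ^ e) ⊎ (∃ λ t → 2 ^ t < k × k < 2 ^ suc t)
powerOfTwo⊎between k 1≤k = below k (<⇒≤ (n<2^n k))
  where
  below : ∀ t → k ≤ 2 ^ t → (∃ λ e → k ≡ 2 ^ e) ⊎ (∃ λ t → 2 ^ t < k × k < 2 ^ suc t)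
  below zero    k≤1 = inj₁ (0 , ≤-antisym k≤1 1≤k)
  below (suc t) k≤2^suc with k ≤? 2 ^ t | k ≟ 2 ^ suc t
  ... | yes k≤2^t | _         = below t k≤2^t
  ... | no  k≰2^t | yes k≡2^  = inj₁ (suc t , k≡2^)
  ... | no  k≰2^t | no  k≢2^  = inj₂ (t , ≰⇒> k≰2^t , ≤∧≢⇒< k≤2^suc k≢2^)

%-shift : ∀ m .{{_ : NonZero m}} x y → (x + y + (m ∸ x % m)) % m ≡ y % m
%-shift m x y = begin
  (x + y + d) % m                ≡⟨ %-congˡ (cong (λ z → z + y + d) (m≡m%n+[m/n]*n x m)) ⟩
  (x % m + q * m + y + d) % m    ≡⟨ %-congˡ (solve 5 (λ r q m y d → r :+ q :* m :+ y :+ d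
                                                                 := y :+ (r :+ d) :+ q :* m)
                                              refl (x % m) q m y d) ⟩
  (y + (x % m + d) + q * m) % m  ≡⟨ %-congˡ (cong (λ z → y + z + q * m) (m+[n∸m]≡n (m%n≤n x m))) ⟩
  (y + m + q * m) % m            ≡⟨ %-congˡ (+-assoc y m (q * m)) ⟩
  (y + suc q * m) % m            ≡⟨ [m+kn]%n≡m%n y (suc q) m ⟩
  y % m                          ∎
  where
  open +-*-Solver
  d = m ∸ x % m
  q = x / m

+-%-cancelˡ : ∀ m .{{_ : NonZero m}} x {y z} → (x + y) % m ≡ (x + z) % m → y % m ≡ z % m
+-%-cancelˡ m x {y} {z} eq = begin
  y % m                       ≡⟨ %-shift m x y ⟨
  (x + y + d) % m             ≡⟨ %-distribˡ-+ (x + y) d m ⟩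
  ((x + y) % m + d % m) % m   ≡⟨ cong (λ r → (r + d % m) % m) eq ⟩
  ((x + z) % m + d % m) % m   ≡⟨ %-distribˡ-+ (x + z) d m ⟨
  (x + z + d) % m             ≡⟨ %-shift m x z ⟩
  z % m                       ∎
  where
  d = m ∸ x % m

1≤m≤n⇒pred[m]<n : ∀ {m n} → 1 ≤ m → m ≤ n → pred m < n
1≤m≤n⇒pred[m]<n {suc m} _ m<n = m<n

-- Colourings of a graph

Searchable : Set → Set₁
Searchable V = ∀ {P : V → Set} → (∀ x → Dec (P x)) → Dec (∃ P)

searchable-× : ∀ {V W} → Searchable V → Searchable W → Searchable (V × W)
searchable-× searchV searchW P? =
  map′ (λ (v , w , p) → (v , w) , p) (λ ((v , w) , p) → v , w , p)
       (searchV (λ v → searchW (λ w → P? (v , w))))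

∃-minimal : ∀ {V} {_<_ : V → V → Set} → WellFounded _<_ → Searchable V → Decidable _<_
  → V → ∃ λ s → ∀ w → ¬ w < s
∃-minimal {V} {_<_} wf search _<?_ = All.wfRec wf _ Minimal step
  where
  Minimal : V → Set
  Minimal _ = ∃ λ s → ∀ w → ¬ w < s
  step : ∀ x → WfRec _<_ Minimal x → Minimal x
  step x below with search (_<? x)
  ... | yes (y , y<x) = below y<x
  ... | no  none      = x , λ w w<x → none (w , w<x)

module _ {V : Set} {A : V → V → Set} where

  usesExactly-interval : ∀ {k c} → (∀ v → 1 ≤ c v × c v ≤ k)
    → (∀ j → 1 ≤ j → j ≤ k → ∃ λ v → c v ≡ j) → UsesExactly A c k
  usesExactly-interval {k} {c} range hits =
    colour , (λ e → toℕ-injective (suc-injective e)) ,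
    (λ i → hits (colour i) z<s (toℕ<n i)) , index
    where
    colour : Fin k → ℕ
    colour i = suc (toℕ i)
    index : ∀ v → ∃ λ i → colour i ≡ c v
    index v = let (1≤cv , cv≤k) = range v; pred< = 1≤m≤n⇒pred[m]<n 1≤cv cv≤k in
      fromℕ< pred< , trans (cong suc (toℕ-fromℕ< pred<)) (suc-pred (c v) {{>-nonZero 1≤cv}})

  chromatic-attainsTop : ∀ {k c} → V → Searchable V → IsChromaticNumber A k
    → ProperColoring A k c → ∃ λ v → c v ≡ k
  chromatic-attainsTop {k} {c} v₀ search (_ , optimal) (range , proper) with search (λ v → c v ≟ k)
  ... | yes attained = attained
  ... | no  missed   = contradiction (optimal (pred k) c (range′ , proper)) (<⇒≱ pred[k]<k)
    where
    range′ : ∀ v → 1 ≤ c v × c v ≤ pred k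
    range′ v = proj₁ (range v) , <⇒≤pred (≤∧≢⇒< (proj₂ (range v)) (λ e → missed (v , e)))
    pred[k]<k : pred k < k
    pred[k]<k = 1≤m≤n⇒pred[m]<n (≤-trans (proj₁ (range v₀)) (proj₂ (range v₀))) ≤-refl

  module _ {before : V → V → Set} where

    firstFit-resp : ∀ {c c'} → (∀ v → c v ≡ c' v) → IsFirstFit A before c → IsFirstFit A before c'
    firstFit-resp c≗c' firstFit v =
      let (1≤cv , distinct , earlier) = firstFit v in
      subst (1 ≤_) (c≗c' v) 1≤cv ,
      (λ u adj u<v → distinct u adj u<v ∘ subst₂ _≡_ (sym (c≗c' u)) (sym (c≗c' v))) ,
      (λ m 1≤m m<c'v →
        let (u , adj , u<v , cu≡m) = earlier m 1≤m (<-≤-trans m<c'v (≤-reflexive (sym (c≗c' v))))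
        in u , adj , u<v , trans (sym (c≗c' u)) cu≡m)

    firstFit-downClosed : ∀ {c j v} → IsFirstFit A before c → 1 ≤ j → j ≤ c v
      → ∃ λ u → c u ≡ j
    firstFit-downClosed {v = v} firstFit 1≤j j≤cv with m≤n⇒m<n∨m≡n j≤cv
    ... | inj₁ j<cv  = let (u , _ , _ , cu≡j) = proj₂ (proj₂ (firstFit v)) _ 1≤j j<cv in u , cu≡j
    ... | inj₂ j≡cv = v , sym j≡cv

    -- If no neighbour preceding v had colour x < c v, then v together with its neighbours of
    -- colour x would be a descent.
    descentFree⇒firstFit : ∀ {k c} → Searchable V → Decidable A → Decidable before → Symmetric A
      → (∀ {v} → ¬ A v v) → (∀ {u v} → u ≢ v → before u v ⊎ before v u)
      → ProperColoring A k c → DescentFree A before c → IsFirstFit A before c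
    descentFree⇒firstFit {c = c} search A? before? symA irreflA total (range , proper) noDescent v =
      proj₁ (range v) , (λ u adj _ → proper u v adj) , earlier
      where
      earlier : ∀ x → 1 ≤ x → x < c v → ∃ λ u → A u v × before u v × c u ≡ x
      earlier x 1≤x x<cv with search (λ u → A? u v ×-dec before? u v ×-dec c u ≟ x)
      ... | yes found = found
      ... | no  none  = ⊥-elim (noDescent x (c v) v (1≤x , x<cv , refl , laterNeighbours))
        where
        laterNeighbours : ∀ u → A v u → c u ≡ x → before v u
        laterNeighbours u adj cu≡x with total {v} {u} (λ { refl → irreflA adj })
        ... | inj₁ v<u = v<u
        ... | inj₂ u<v = ⊥-elim (none (u , symA adj , u<v , cu≡x))

-- The Cartesian square under the lexicographic order

Precedes : ∀ {n} → LinearOrdering n → Fin n → Fin n → Set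
Precedes (σ , _) u v = toℕ (σ u) < toℕ (σ v)

module _ {n : ℕ} (σ : LinearOrdering n) where

  precedes-wellFounded : WellFounded (Precedes σ)
  precedes-wellFounded = On.wellFounded (λ u → toℕ (proj₁ σ u)) <-wellFounded

  precedes-dec : Decidable (Precedes σ)
  precedes-dec u v = toℕ (proj₁ σ u) <? toℕ (proj₁ σ v)

  precedes-total : ∀ {u v} → u ≢ v → Precedes σ u v ⊎ Precedes σ v u
  precedes-total {u} {v} u≢v with <-cmp (toℕ (proj₁ σ u)) (toℕ (proj₁ σ v))
  ... | tri< u<v _ _ = inj₁ u<v
  ... | tri≈ _ σu≡σv _ = contradiction (proj₂ σ (toℕ-injective σu≡σv)) u≢v
  ... | tri> _ _ v<u = inj₂ v<u

  lex-wellFounded : WellFounded (Lex σ)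
  lex-wellFounded = ×-wellFounded precedes-wellFounded precedes-wellFounded

  lex-dec : Decidable (Lex σ)
  lex-dec (u , v) (u' , v') = precedes-dec u u' ⊎-dec (u ≟ᶠ u' ×-dec precedes-dec v v')

  lex-total : ∀ {x y} → x ≢ y → Lex σ x y ⊎ Lex σ y x
  lex-total {u , v} {u' , v'} x≢y with u ≟ᶠ u'
  ... | no  u≢u' = Sum.map inj₁ inj₁ (precedes-total u≢u')
  ... | yes refl = Sum.map (λ v<v' → inj₂ (refl , v<v')) (λ v'<v → inj₂ (refl , v'<v))
                           (precedes-total (λ { refl → x≢y refl }))

module _ {n : ℕ} (G : SimpleGraph n) where

  box-sym : Symmetric (BoxAdj G)
  box-sym (inj₁ (refl , adj)) = inj₁ (refl , SimpleGraph.sym G adj)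
  box-sym (inj₂ (adj , refl)) = inj₂ (SimpleGraph.sym G adj , refl)

  box-irrefl : ∀ {x} → ¬ BoxAdj G x x
  box-irrefl (inj₁ (_ , adj)) = SimpleGraph.irrefl G adj
  box-irrefl (inj₂ (adj , _)) = SimpleGraph.irrefl G adj

  box-dec : Decidable (BoxAdj G)
  box-dec (u , v) (u' , v') =
    (u ≟ᶠ u' ×-dec SimpleGraph.dec G v v') ⊎-dec (SimpleGraph.dec G u u' ×-dec v ≟ᶠ v')

  row-proper : ∀ {k c} → ProperColoring (BoxAdj G) k c
    → ∀ u → ProperColoring (Adj G) k (λ v → c (u , v))
  row-proper (range , proper) u =
    (λ v → range (u , v)) , (λ v v' adj → proper (u , v) (u , v') (inj₁ (refl , adj)))

  -- A cyclic Latin square on the colour classes of b; it shows χ(G □ G) ≤ χ(G).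
  latinColoring : (m : ℕ) .{{_ : NonZero m}} → (Fin n → ℕ) → Fin n × Fin n → ℕ
  latinColoring m b (u , v) = suc ((pred (b u) + pred (b v)) % m)

  latinColoring-proper : ∀ {m b} .{{_ : NonZero m}} → ProperColoring (Adj G) m b
    → ProperColoring (BoxAdj G) m (latinColoring m b)
  latinColoring-proper {m} {b} (range , proper) = (λ (u , v) → z<s , m%n<n _ m) , distinct
    where
    colour≡ : ∀ {v v'} → pred (b v) % m ≡ pred (b v') % m → b v ≡ b v'
    colour≡ {v} {v'} eq =
      let (1≤bv , bv≤m) = range v; (1≤bv' , bv'≤m) = range v' in
      pred-injective {{>-nonZero 1≤bv}} {{>-nonZero 1≤bv'}}
        (trans (sym (m<n⇒m%n≡m (1≤m≤n⇒pred[m]<n 1≤bv bv≤m)))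
               (trans eq (m<n⇒m%n≡m (1≤m≤n⇒pred[m]<n 1≤bv' bv'≤m))))
    distinct : ∀ x y → BoxAdj G x y → latinColoring m b x ≢ latinColoring m b y
    distinct (u , v) (_ , v') (inj₁ (refl , adj)) eq =
      proper v v' adj (colour≡ (+-%-cancelˡ m (pred (b u)) (suc-injective eq)))
    distinct (u , v) (u' , _) (inj₂ (adj , refl)) eq =
      proper u u' adj (colour≡ (+-%-cancelˡ m (pred (b v))
        (subst₂ (λ i j → i % m ≡ j % m) (+-comm (pred (b u)) _) (+-comm (pred (b u')) _)
                (suc-injective eq))))

  chromatic-box⇒chromatic : ∀ {k} → Fin n
    → IsChromaticNumber (BoxAdj G) k → IsChromaticNumber (Adj G) k
  chromatic-box⇒chromatic {k} u₀ ((_ , proper) , optimal) = (_ , row-proper proper u₀) , lower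
    where
    lower : ∀ m b → ProperColoring (Adj G) m b → k ≤ m
    lower m _ coloring@(range , _) =
      let instance _ = >-nonZero (≤-trans (proj₁ (range u₀)) (proj₂ (range u₀)))
      in optimal m _ (latinColoring-proper coloring)

module _ {n : ℕ} (G : SimpleGraph n) (σ : LinearOrdering n) where

  data EarlierNeighbour (u v : Fin n) : Fin n × Fin n → Set where
    inRow    : ∀ {v'} → Adj G v' v → Precedes σ v' v → EarlierNeighbour u v (u , v')
    inColumn : ∀ {u'} → Adj G u' u → Precedes σ u' u → EarlierNeighbour u v (u' , v)

  earlierNeighbour : ∀ {w u v} → BoxAdj G w (u , v) → Lex σ w (u , v) → EarlierNeighbour u v w
  earlierNeighbour (inj₁ (refl , _))   (inj₁ u<u)         = contradiction u<u (<-irrefl refl)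
  earlierNeighbour (inj₁ (refl , adj)) (inj₂ (_ , v'<v))  = inRow adj v'<v
  earlierNeighbour (inj₂ (adj , refl)) (inj₁ u'<u)        = inColumn adj u'<u
  earlierNeighbour (inj₂ (adj , refl)) (inj₂ (refl , _))  = contradiction adj (SimpleGraph.irrefl G)

  firstFit-row : ∀ {c s} → IsFirstFit (BoxAdj G) (Lex σ) c → (∀ u → ¬ Precedes σ u s)
    → IsFirstFit (Adj G) (Precedes σ) (λ v → c (s , v))
  firstFit-row {c} {s} firstFit minimal v =
    let (1≤c , distinct , earlier) = firstFit (s , v) in
    1≤c ,
    (λ v' adj v'<v → distinct (s , v') (inj₁ (refl , adj)) (inj₂ (refl , v'<v))) ,
    (λ x 1≤x x<c → inRowOnly (earlier x 1≤x x<c))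
    where
    inRowOnly : ∀ {x} → (∃ λ w → BoxAdj G w (s , v) × Lex σ w (s , v) × c w ≡ x)
      → ∃ λ v' → Adj G v' v × Precedes σ v' v × c (s , v') ≡ x
    inRowOnly (w , adj , w<sv , cw≡x) with earlierNeighbour adj w<sv
    ... | inRow adj' v'<v   = _ , adj' , v'<v , cw≡x
    ... | inColumn _ u'<s  = contradiction u'<s (minimal _)

  firstFit-box≡nim : ∀ {T a c} → IsFirstFit (Adj G) (Precedes σ) (suc ∘ a) → (∀ u → a u < 2 ^ T)
    → IsFirstFit (BoxAdj G) (Lex σ) c → ∀ x → c x ≡ suc (nim T (a (proj₁ x)) (a (proj₂ x)))
  firstFit-box≡nim {T} {a} {c} firstFitᴳ a< firstFit =
    All.wfRec (lex-wellFounded σ) _ NimColoured (λ _ ih → ≤-antisym (notAbove ih) (notBelow ih))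
    where
    NimColoured : Fin n × Fin n → Set
    NimColoured x = c x ≡ suc (nim T (a (proj₁ x)) (a (proj₂ x)))

    notAbove : ∀ {u v} → WfRec (Lex σ) NimColoured (u , v) → c (u , v) ≤ suc (nim T (a u) (a v))
    notAbove {u} {v} ih = ≮⇒≥ λ above → noEarlier (proj₂ (proj₂ (firstFit (u , v))) _ z<s above)
      where
      noEarlier : ¬ ∃ λ w → BoxAdj G w (u , v) × Lex σ w (u , v) × c w ≡ suc (nim T (a u) (a v))
      noEarlier (w , adj , w<x , cw≡) with earlierNeighbour adj w<x
      ... | inRow {v'} adj' v'<v =
        proj₁ (proj₂ (firstFitᴳ v)) v' adj' v'<v (cong suc (nim-cancelˡ-≡ T (a< u) (a< v') (a< v)
          (suc-injective (trans (sym (ih (inj₂ (refl , v'<v)))) cw≡))))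
      ... | inColumn {u'} adj' u'<u =
        proj₁ (proj₂ (firstFitᴳ u)) u' adj' u'<u (cong suc (nim-cancelʳ-≡ T (a< u') (a< u) (a< v)
          (suc-injective (trans (sym (ih (inj₁ u'<u))) cw≡))))

    notBelow : ∀ {u v} → WfRec (Lex σ) NimColoured (u , v) → suc (nim T (a u) (a v)) ≤ c (u , v)
    notBelow {u} {v} ih = ≮⇒≥ λ below →
      let pred[c]<nim = 1≤m≤n⇒pred[m]<n 1≤c (s≤s⁻¹ below)
          (w , adj , w<x , cw≡c) = optionColour (nim-mex T (a< u) (a< v) pred[c]<nim)
      in proj₁ (proj₂ (firstFit (u , v))) w adj w<x cw≡c
      where
      1≤c : 1 ≤ c (u , v)
      1≤c = proj₁ (firstFit (u , v))
      suc-pred-c : suc (pred (c (u , v))) ≡ c (u , v)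
      suc-pred-c = suc-pred (c (u , v)) {{>-nonZero 1≤c}}
      optionColour : OptionValue T (a u) (a v) (pred (c (u , v)))
        → ∃ λ w → BoxAdj G w (u , v) × Lex σ w (u , v) × c w ≡ c (u , v)
      optionColour (inj₁ (a' , a'<au , e)) =
        let (u' , adj , u'<u , e') = proj₂ (proj₂ (firstFitᴳ u)) (suc a') z<s (s<s a'<au) in
        (u' , v) , inj₂ (adj , refl) , inj₁ u'<u , (begin
          c (u' , v)               ≡⟨ ih {u' , v} (inj₁ u'<u) ⟩
          suc (nim T (a u') (a v)) ≡⟨ cong (λ i → suc (nim T i (a v))) (suc-injective e') ⟩
          suc (nim T a' (a v))     ≡⟨ cong suc e ⟩
          suc (pred (c (u , v)))   ≡⟨ suc-pred-c ⟩
          c (u , v)                ∎)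
      optionColour (inj₂ (b' , b'<av , e)) =
        let (v' , adj , v'<v , e') = proj₂ (proj₂ (firstFitᴳ v)) (suc b') z<s (s<s b'<av) in
        (u , v') , inj₁ (refl , adj) , inj₂ (refl , v'<v) , (begin
          c (u , v')               ≡⟨ ih {u , v'} (inj₂ (refl , v'<v)) ⟩
          suc (nim T (a u) (a v')) ≡⟨ cong (λ j → suc (nim T (a u) j)) (suc-injective e') ⟩
          suc (nim T (a u) b')     ≡⟨ cong suc e ⟩
          suc (pred (c (u , v)))   ≡⟨ suc-pred-c ⟩
          c (u , v)                ∎)

  firstFit-box-powerOfTwo : ∀ {c k s} → IsFirstFit (BoxAdj G) (Lex σ) c → (∀ x → c x ≤ k)
    → (∀ u → ¬ Precedes σ u s) → (∀ j → 1 ≤ j → j ≤ k → ∃ λ u → c (s , u) ≡ j)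
    → ∃ λ e → k ≡ 2 ^ e
  firstFit-box-powerOfTwo {c} {k} {s} firstFit c≤k least rowHits =
    Sum.[ id , (λ (t , 2^t<k , k<2^suc) → ⊥-elim (notBetween t 2^t<k k<2^suc)) ]
      (powerOfTwo⊎between k (≤-trans (proj₁ (firstFit (s , s))) (c≤k (s , s))))
    where
    notBetween : ∀ t → 2 ^ t < k → k < 2 ^ suc t → ⊥
    notBetween t 2^t<k k<2^suc = contradiction (subst (_≤ k) colour-pq (c≤k (p , q))) (<⇒≱ k<2^suc)
      where
      a : Fin n → ℕ
      a u = pred (c (s , u))
      1≤row : ∀ u → 1 ≤ c (s , u)
      1≤row u = proj₁ (firstFit (s , u))
      firstFitᴳ : IsFirstFit (Adj G) (Precedes σ) (suc ∘ a)
      firstFitᴳ = firstFit-resp (λ u → sym (suc-pred (c (s , u)) {{>-nonZero (1≤row u)}}))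
                                (firstFit-row firstFit least)
      a< : ∀ u → a u < 2 ^ suc t
      a< u = 1≤m≤n⇒pred[m]<n (1≤row u) (≤-trans (c≤k (s , u)) (<⇒≤ k<2^suc))
      p q : Fin n
      p = proj₁ (rowHits (suc (2 ^ t)) z<s 2^t<k)
      q = proj₁ (rowHits (2 ^ t) (m^n>0 2 t) (<⇒≤ 2^t<k))
      colour-pq : c (p , q) ≡ 2 ^ suc t
      colour-pq = begin
        c (p , q)
          ≡⟨ firstFit-box≡nim {suc t} firstFitᴳ a< firstFit (p , q) ⟩
        suc (nim (suc t) (a p) (a q))
          ≡⟨ cong₂ (λ i j → suc (nim (suc t) (pred i) (pred j)))
                   (proj₂ (rowHits (suc (2 ^ t)) z<s 2^t<k))
                   (proj₂ (rowHits (2 ^ t) (m^n>0 2 t) (<⇒≤ 2^t<k))) ⟩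
        suc (nim (suc t) (2 ^ t) (pred (2 ^ t)))
          ≡⟨ nim-2^t-pred t ⟩
        2 ^ suc t ∎

corollary1 : (n : ℕ) → 1 ≤ n → (G : SimpleGraph n) → (σ : LinearOrdering n)
    → (k : ℕ) → IsChromaticNumber (BoxAdj G) k
    → (c : Fin n × Fin n → ℕ) → ProperColoring (BoxAdj G) k c
    → DescentFree (BoxAdj G) (Lex σ) c
    → Σ ℕ λ e → IsChromaticNumber (Adj G) (2 ^ e) × FFNumber (BoxAdj G) (Lex σ) (2 ^ e)
corollary1 (suc n) _ G σ k χ□ c proper descentFree =
  let (e , k≡2^e) = firstFit-box-powerOfTwo G σ firstFit (proj₂ ∘ proj₁ proper) least rowHits in
  e , subst Goal k≡2^e (χᴳ , c , firstFit , usesExactly-interval {A = BoxAdj G} (proj₁ proper) hits)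
  where
  Goal : ℕ → Set
  Goal m = IsChromaticNumber (Adj G) m × FFNumber (BoxAdj G) (Lex σ) m
  firstFit : IsFirstFit (BoxAdj G) (Lex σ) c
  firstFit = descentFree⇒firstFit (searchable-× any? any?) (box-dec G) (lex-dec σ)
               (box-sym G) (box-irrefl G) (lex-total σ) proper descentFree
  minimal : ∃ λ s → ∀ u → ¬ Precedes σ u s
  minimal = ∃-minimal (precedes-wellFounded σ) any? (precedes-dec σ) zero
  s : Fin (suc n)
  s = proj₁ minimal
  least : ∀ u → ¬ Precedes σ u s
  least = proj₂ minimal
  χᴳ : IsChromaticNumber (Adj G) k
  χᴳ = chromatic-box⇒chromatic G zero χ□
  rowHits : ∀ j → 1 ≤ j → j ≤ k → ∃ λ u → c (s , u) ≡ j
  rowHits j 1≤j j≤k =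
    let (u , row≡k) = chromatic-attainsTop zero any? χᴳ (row-proper G proper s) in
    firstFit-downClosed (firstFit-row G σ firstFit least) 1≤j (subst (j ≤_) (sym row≡k) j≤k)
  hits : ∀ j → 1 ≤ j → j ≤ k → ∃ λ x → c x ≡ j
  hits j 1≤j j≤k = let (u , row≡j) = rowHits j 1≤j j≤k in (s , u) , row≡j
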